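{- Let $(Q,\rightarrow)$ be a finite transition system, $\mathscr{R}$ a preorder on $Q$ and $\mathscr{P}$ an equivalence relation with $\mathscr{P}\subseteq\mathscr{R}$, where each block $E$ of $\mathscr{P}$ has a fixed representative $E.\mathit{rep}\in E$. Let $E$ be a block of $\mathscr{P}$, $B$ a block of $\mathscr{R}$ and $B'$ a nonempty subset of $B$. Then $\mathrm{RelCount}_{(\mathscr{P},\mathscr{R})}(E,B)=\mathrm{RelCount}_{(\mathscr{P},\mathscr{R})}(E,B')$.
   Context: Blocks of a preorder $\mathscr{R}$ are the sets $[q]_{\mathscr{R}}=\{q'\mid q\,\mathscr{R}\,q'\wedge q'\,\mathscr{R}\,q\}$. For sets $X,Y$, write $X\,\mathscr{R}\,Y$ if $(X\times Y)\cap\mathscr{R}\neq\emptyset$, and $q\rightarrow Y$ if $q\rightarrow y$ for some $y\in Y$. For a block $E$ of $\mathscr{P}$ and any subset $B'$ of a block of $\mathscr{R}$, $\mathrm{RelCount}_{(\mathscr{P},\mathscr{R})}(E,B')=|\{E'\text{ block of }\mathscr{P}\mid E.\mathit{rep}\rightarrow E'\ \wedge\ B'\,\mathscr{R}\,E'\}|$. -}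

module Defs where

open import Level using (0ℓ)
open import Data.Bool using (true; false)
open import Data.Nat using (ℕ; zero; suc)
open import Data.Fin using (Fin)
open import Data.Fin.Properties using (any?; all?)
open import Data.Fin.Subset using (Subset; _∈_)
open import Data.Fin.Subset.Properties using (_∈?_)
open import Data.Vec using ([]; _∷_)
open import Data.List using (List; [_]; map; _++_; filter; length)
open import Data.Product using (_×_; ∃; ∃-syntax; _,_)
open import Relation.Nullary using (Dec)
open import Relation.Nullary.Decidable using (_×-dec_; _→-dec_)
open import Relation.Binary using (Rel; Decidable; IsPreorder; IsEquivalence; _⇒_)
open import Relation.Binary.PropositionalEquality using (_≡_)

-- The state space Q of a finite transition system is Fin n.

block : ∀ {n} → Rel (Fin n) 0ℓ → Fin n → Fin n → Set
block 𝓡 q x = 𝓡 q x × 𝓡 x q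

IsBlock : ∀ {n} → Rel (Fin n) 0ℓ → Subset n → Set
IsBlock 𝓡 X = ∃[ q ] (∀ x → (x ∈ X → block 𝓡 q x) × (block 𝓡 q x → x ∈ X))

SetRel : ∀ {n} → Rel (Fin n) 0ℓ → Subset n → Subset n → Set
SetRel 𝓡 X Y = ∃[ x ] ∃[ y ] (x ∈ X × y ∈ Y × 𝓡 x y)

StepTo : ∀ {n} → Rel (Fin n) 0ℓ → Fin n → Subset n → Set
StepTo _⟶_ q Y = ∃[ y ] (y ∈ Y × q ⟶ y)

-- Enumeration of all subsets of Fin n (without duplicates).
allSubsets : (n : ℕ) → List (Subset n)
allSubsets zero = [ [] ]
allSubsets (suc n) = map (true ∷_) (allSubsets n) ++ map (false ∷_) (allSubsets n)

record Setting (n : ℕ) : Set₁ where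
  field
    _⟶_    : Rel (Fin n) 0ℓ
    _⟶?_   : Decidable _⟶_
    𝓡      : Rel (Fin n) 0ℓ
    𝓡?     : Decidable 𝓡
    𝓡-pre  : IsPreorder _≡_ 𝓡
    𝓟      : Rel (Fin n) 0ℓ
    𝓟?     : Decidable 𝓟
    𝓟-eq   : IsEquivalence 𝓟
    𝓟⊆𝓡    : 𝓟 ⇒ 𝓡
    rep    : Subset n → Fin n
    rep∈   : ∀ E → IsBlock 𝓟 E → rep E ∈ E

module _ {n : ℕ} (S : Setting n) where
  open Setting S

  private
    block? : ∀ (𝓢 : Rel (Fin n) 0ℓ) → Decidable 𝓢 → ∀ q x → Dec (block 𝓢 q x)
    block? 𝓢 𝓢? q x = 𝓢? q x ×-dec 𝓢? x q

    isBlock? : ∀ (𝓢 : Rel (Fin n) 0ℓ) → Decidable 𝓢 → ∀ X → Dec (IsBlock 𝓢 X)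
    isBlock? 𝓢 𝓢? X = any? λ q → all? λ x →
      ((x ∈? X) →-dec block? 𝓢 𝓢? q x) ×-dec (block? 𝓢 𝓢? q x →-dec (x ∈? X))

    setRel? : ∀ X Y → Dec (SetRel 𝓡 X Y)
    setRel? X Y = any? λ x → any? λ y → (x ∈? X) ×-dec ((y ∈? Y) ×-dec 𝓡? x y)

    stepTo? : ∀ q Y → Dec (StepTo _⟶_ q Y)
    stepTo? q Y = any? λ y → (y ∈? Y) ×-dec (q ⟶? y)

  Counted : Subset n → Subset n → Subset n → Set
  Counted E B' E' = IsBlock 𝓟 E' × StepTo _⟶_ (rep E) E' × SetRel 𝓡 B' E'

  Counted? : ∀ E B' E' → Dec (Counted E B' E')
  Counted? E B' E' = isBlock? 𝓟 𝓟? E' ×-dec (stepTo? (rep E) E' ×-dec setRel? B' E')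

  -- RelCount_(𝓟,𝓡)(E, B') = |{ E' block of 𝓟 | E.rep → E' ∧ B' 𝓡 E' }|
  RelCount : Subset n → Subset n → ℕ
  RelCount E B' = length (filter (Counted? E B') (allSubsets n))

module Submission where

-- Only the condition B' 𝓡 E' depends on B', so it suffices to show that,
-- for a block B of the preorder 𝓡 and any nonempty B' ⊆ B, the relations
-- B 𝓡 Y and B' 𝓡 Y coincide for every set Y.  One direction is monotonicity
-- of _𝓡_ on sets in its left argument.  For the other, all elements of a
-- block of a preorder are 𝓡-equivalent, so a witness x 𝓡 y with x ∈ B can
-- be transported to b 𝓡 y for any chosen b ∈ B'.

open import Defs
open import Level using (0ℓ)
open import Data.Nat using (ℕ)
open import Data.Fin using (Fin)
open import Data.Fin.Subset using (Subset; _∈_; _⊆_; Nonempty)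
open import Data.List.Properties using (filter-≐)
open import Data.Product using (_,_; proj₁; proj₂; map₂)
open import Relation.Unary using (_≐_)
open import Relation.Binary using (Rel; IsPreorder)
open import Relation.Binary.PropositionalEquality using (_≡_; cong)
open import Data.List using (length)

setRel-⊆ : ∀ {n} (𝓡 : Rel (Fin n) 0ℓ) {X X' Y : Subset n}
  → X' ⊆ X → SetRel 𝓡 X' Y → SetRel 𝓡 X Y
setRel-⊆ 𝓡 X'⊆X (x , y , x∈ , y∈ , xRy) = x , y , X'⊆X x∈ , y∈ , xRy

module _ {n} {𝓡 : Rel (Fin n) 0ℓ} (𝓡-pre : IsPreorder _≡_ 𝓡) where
  open IsPreorder 𝓡-pre using (trans)

  block-related : ∀ {B x b} → IsBlock 𝓡 B → x ∈ B → b ∈ B → 𝓡 b x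
  block-related (_ , hB) x∈ b∈ =
    trans (proj₂ (proj₁ (hB _) b∈)) (proj₁ (proj₁ (hB _) x∈))

  setRel-block-part : ∀ {B B' Y} → IsBlock 𝓡 B → B' ⊆ B → Nonempty B'
    → SetRel 𝓡 B Y → SetRel 𝓡 B' Y
  setRel-block-part isB B'⊆B (b , b∈) (x , y , x∈ , y∈ , xRy) =
    b , y , b∈ , y∈ , trans (block-related isB x∈ (B'⊆B b∈)) xRy

  setRel-block-≐ : ∀ {B B'} → IsBlock 𝓡 B → B' ⊆ B → Nonempty B'
    → SetRel 𝓡 B ≐ SetRel 𝓡 B'
  setRel-block-≐ isB B'⊆B ne =
    setRel-block-part isB B'⊆B ne , setRel-⊆ 𝓡 B'⊆B

counted-≐ : ∀ {n} (S : Setting n) (E : Subset n) {B B' : Subset n}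
  → SetRel (Setting.𝓡 S) B ≐ SetRel (Setting.𝓡 S) B'
  → Counted S E B ≐ Counted S E B'
counted-≐ S E (to , from) =
  map₂ (map₂ to) , map₂ (map₂ from)

proposition4 : (n : ℕ) (S : Setting n) (E B B' : Subset n)
    → IsBlock (Setting.𝓟 S) E → IsBlock (Setting.𝓡 S) B
    → B' ⊆ B → Nonempty B'
    → RelCount S E B ≡ RelCount S E B'
proposition4 n S E B B' _ isB B'⊆B ne =
  cong length (filter-≐ (Counted? S E B) (Counted? S E B') counted≐ (allSubsets n))
  where
    counted≐ : Counted S E B ≐ Counted S E B'
    counted≐ = counted-≐ S E (setRel-block-≐ (Setting.𝓡-pre S) isB B'⊆B ne)
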